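{- The rule $R_3$ is derivable in $ALFA_{Io}$: for all graphs $A,B$, $[A]\vdash_{ALFA_{Io}}[AB]$.
   Context: Graphs: the empty graph $\emptyset$ and propositional letters are graphs; if $G,H$ are graphs then so are the juxtaposition $GH$, the cut $[G]$ ($G$ inside a solid closed curve), the implication graph $\langle G\Rightarrow H\rangle$ (a solid closed curve containing $G$ and a dotted closed curve containing $H$), and the disjunction graph $\langle G\vee H\rangle$ (a solid closed curve containing two semi-dotted closed curves, one containing $G$ and one containing $H$; $\langle G\vee H\rangle=\langle H\vee G\rangle$). Juxtaposition is associative and commutative with unit $\emptyset$; $[\,]$ is the empty cut. Rules are schemata with $A,B,C$ arbitrary (possibly empty) graphs, applied to the whole graph on the sheet. The system $ALFA_{Io}$ has first-degree rules $MP_i: A\langle A\Rightarrow B\rangle\vdash B$; $I_\vee: A\vdash\langle A\vee B\rangle$; $R_2: AB\vdash A$; $I_{p3}:\langle A\vee B\rangle\vdash\langle[A]\Rightarrow B\rangle$; $I_{p2}: [AB]\vdash\langle A\Rightarrow[B]\rangle$; $E_p:\langle A\Rightarrow B\rangle\vdash[A[B]]$; and second-degree rules $R_{8i}$: if $AB\vdash C$ then $A\vdash\langle B\Rightarrow C\rangle$; $R_0$: if $A\vdash B$ and $A\vdash C$ then $A\vdash BC$; $E_\vee$: if $A\vdash C$ and $B\vdash C$ then $\langle A\vee B\rangle\vdash C$. $\vdash_{ALFA_{Io}}$ is the least transitive relation on graphs containing all instances of the first-degree rules and closed under the second-degree rules. -}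

module Defs where

open import Data.Nat using (ℕ)

data Graph : Set where
  ∅     : Graph
  letter : ℕ → Graph
  _·_   : Graph → Graph → Graph          -- juxtaposition GH
  cut   : Graph → Graph                  -- [G]
  ⟨_⇒_⟩ : Graph → Graph → Graph
  ⟨_∨_⟩ : Graph → Graph → Graph

infixl 6 _·_

data _≈_ : Graph → Graph → Set where
  ≈-refl  : ∀ {G} → G ≈ G
  ≈-sym   : ∀ {G H} → G ≈ H → H ≈ G
  ≈-trans : ∀ {G H K} → G ≈ H → H ≈ K → G ≈ K
  ·-assoc : ∀ {G H K} → (G · H) · K ≈ G · (H · K)
  ·-comm  : ∀ {G H} → G · H ≈ H · G
  ·-unitˡ : ∀ {G} → ∅ · G ≈ G
  ∨-comm  : ∀ {G H} → ⟨ G ∨ H ⟩ ≈ ⟨ H ∨ G ⟩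
  ·-cong  : ∀ {G G' H H'} → G ≈ G' → H ≈ H' → G · H ≈ G' · H'
  cut-cong : ∀ {G G'} → G ≈ G' → cut G ≈ cut G'
  ⇒-cong  : ∀ {G G' H H'} → G ≈ G' → H ≈ H' → ⟨ G ⇒ H ⟩ ≈ ⟨ G' ⇒ H' ⟩
  ∨-cong  : ∀ {G G' H H'} → G ≈ G' → H ≈ H' → ⟨ G ∨ H ⟩ ≈ ⟨ G' ∨ H' ⟩

infix 4 _≈_ _⊢_

-- Derivability in ALFA_Io: least transitive relation containing the
-- first-degree rules (on graphs up to identity ≈) and closed under the
-- second-degree rules.
data _⊢_ : Graph → Graph → Set where
  same  : ∀ {G H} → G ≈ H → G ⊢ H
  trans : ∀ {G H K} → G ⊢ H → H ⊢ K → G ⊢ K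
  MPᵢ   : ∀ {A B} → A · ⟨ A ⇒ B ⟩ ⊢ B
  I∨    : ∀ {A B} → A ⊢ ⟨ A ∨ B ⟩
  R₂    : ∀ {A B} → A · B ⊢ A
  Ip₃   : ∀ {A B} → ⟨ A ∨ B ⟩ ⊢ ⟨ cut A ⇒ B ⟩
  Ip₂   : ∀ {A B} → cut (A · B) ⊢ ⟨ A ⇒ cut B ⟩
  Ep    : ∀ {A B} → ⟨ A ⇒ B ⟩ ⊢ cut (A · cut B)
  R₈ᵢ   : ∀ {A B C} → A · B ⊢ C → A ⊢ ⟨ B ⇒ C ⟩
  R₀    : ∀ {A B C} → A ⊢ B → A ⊢ C → A ⊢ B · C
  E∨    : ∀ {A B C} → A ⊢ C → B ⊢ C → ⟨ A ∨ B ⟩ ⊢ C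

-- The empty cut [ ] plays the role of falsum and [[ ]] that of verum.  R₈ᵢ
-- followed by Eₚ turns a refutation AB ⊢ [ ] into A ⊢ [B [[ ]]], and the
-- inner [[ ]] is discharged by Iₚ₂ and modus ponens against the derivable
-- [[ ]].  Since A[A] ⊢ [ ], the graph [A] refutes AB, which gives [A] ⊢ [AB].
module Submission where

open import Defs

falsum : Graph
falsum = cut ∅

verum : Graph
verum = cut falsum

R₂ʳ : ∀ {A B} → A · B ⊢ B
R₂ʳ = trans (same ·-comm) R₂

·-unitʳ : ∀ {A} → A · ∅ ≈ A
·-unitʳ = ≈-trans ·-comm ·-unitˡ

⇒-elim : ∀ {A B C} → A ⊢ B → A ⊢ ⟨ B ⇒ C ⟩ → A ⊢ C
⇒-elim ⊢B ⊢B⇒C = trans (R₀ ⊢B ⊢B⇒C) MPᵢ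

⊢verum : ∀ {A} → A ⊢ verum
⊢verum = trans (R₈ᵢ R₂ʳ) (trans Ep (same (cut-cong ·-unitˡ)))

cut-verum-elim : ∀ {B} → cut (B · verum) ⊢ cut B
cut-verum-elim = ⇒-elim ⊢verum (trans (same (cut-cong ·-comm)) Ip₂)

refute : ∀ {A B} → A · B ⊢ falsum → A ⊢ cut B
refute A·B⊢falsum = trans (R₈ᵢ A·B⊢falsum) (trans Ep cut-verum-elim)

non-contradiction : ∀ {A} → A · cut A ⊢ falsum
non-contradiction = ⇒-elim R₂ (trans R₂ʳ (trans (same (cut-cong (≈-sym ·-unitʳ))) Ip₂))

mainTheorem17 : (A B : Graph) → cut A ⊢ cut (A · B)
mainTheorem17 A B = refute (trans (same regroup) (trans R₂ non-contradiction))
  where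
  regroup : cut A · (A · B) ≈ (A · cut A) · B
  regroup = ≈-trans (≈-sym ·-assoc) (·-cong ·-comm ≈-refl)
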